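{- Let $k,l\ge1$, let $\mu'=(\mu'_1,\ldots,\mu'_k)$ be a partition with $\mu'_k\ge2$, let $\mu=(\mu'_1,\ldots,\mu'_k,2^l)$, and let $\nu$ be a composition. The map $\tau$ described below sends the set $\mathcal{F}_{\mu,\nu}$ of fillings of shape $\mu$ and evaluation $\nu$ to itself, and it is an involution (hence a bijection) on $\mathcal{F}_{\mu,\nu}$.
   Context: Diagrams are in French convention: cells $(i,j)$ with row $i$ counted from the bottom and column $j$ from the left, $1\le j\le\mu_i$. A filling of shape $\mu$ assigns a positive integer $T_{i,j}$ to each cell with no monotonicity condition; its evaluation is the composition $\nu$ whose $m$-th entry is the number of cells with entry $m$; $\mathcal{F}_{\mu,\nu}$ is the set of such fillings. Conditions: $(a,b,A)$ satisfies $xAx$ if $a\le A<b$ or $b\le A<a$. $(a,b,A,B)$ satisfies $xXxX$ if one of the following holds: $a\le A<b\le B$; $A<b\le B<a$; $b\le A<a\le B$; $A<a\le B<b$; $a\le B<b\le A$; $B<b\le A<a$; $b\le B<a\le A$; $B<a\le A<b$. For a filling $S$, "rows $i$ and $i+1$ of $S$ satisfy $xAx$" means $(S_{i+1,1},S_{i+1,2},S_{i,1})$ satisfies $xAx$, and "rows $i$ and $i+1$ satisfy $xXxX$" means $(S_{i+1,1},S_{i+1,2},S_{i,1},S_{i,2})$ satisfies $xXxX$. Definition of $\tau(T)$: set $S\leftarrow T$. If rows $k$ and $k+1$ of $S$ do not satisfy $xAx$, return $S$. Otherwise swap the two entries of row $k+1$ of $S$ and set $i\leftarrow k+1$. Then,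 while $i+1\le k+l$ and rows $i$ and $i+1$ of the current $S$ satisfy $xXxX$, swap the two entries of row $i+1$ of $S$ and set $i\leftarrow i+1$. Return $S$ as $\tau(T)$. -}

module Defs where

open import Data.Nat.Base using (ℕ; zero; suc; _≤_; _<ᵇ_; _≤ᵇ_; _≡ᵇ_; _+_)
open import Data.Bool.Base using (Bool; true; false; _∧_; _∨_; if_then_else_)
open import Data.List.Base using (List; []; _∷_; _++_; take; drop; map; length; replicate; last)
open import Data.List.Relation.Unary.All using (All)
open import Data.List.Relation.Unary.Linked using (Linked)
open import Data.Maybe.Base using (Maybe; just; nothing)
open import Data.Product.Base using (_×_)
open import Relation.Binary.PropositionalEquality using (_≡_)

-- A filling is a list of rows, listed from the bottom row (row 1) upward;
-- each row is the list of its entries from left (column 1) to right.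
Filling : Set
Filling = List (List ℕ)

shape : Filling → List ℕ
shape = map length

IsPartition : List ℕ → Set
IsPartition μ = All (1 ≤_) μ × Linked (λ a b → b ≤ a) μ

IsComposition : List ℕ → Set
IsComposition ν = All (1 ≤_) ν

-- ν_m for m ≥ 1 (1-based); 0 outside the range 1..length ν
part : List ℕ → ℕ → ℕ
part ν zero = 0
part [] (suc m) = 0
part (x ∷ ν) (suc zero) = x
part (x ∷ ν) (suc (suc m)) = part ν (suc m)

countRow : ℕ → List ℕ → ℕ
countRow m [] = 0
countRow m (x ∷ r) = (if m ≡ᵇ x then 1 else 0) + countRow m r

count : ℕ → Filling → ℕ
count m [] = 0
count m (r ∷ T) = countRow m r + count m T

InF : List ℕ → List ℕ → Filling → Set
InF μ ν T = shape T ≡ μ × All (All (1 ≤_)) T × ((m : ℕ) → count m T ≡ part ν m)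

muShape : List ℕ → ℕ → List ℕ
muShape μ' l = μ' ++ replicate l 2

-- entries of a row (column 1 and column 2); 0 if absent (never used on valid fillings)
e1 : List ℕ → ℕ
e1 (a ∷ _) = a
e1 [] = 0

e2 : List ℕ → ℕ
e2 (_ ∷ b ∷ _) = b
e2 _ = 0

xAx : ℕ → ℕ → ℕ → Bool
xAx a b A = ((a ≤ᵇ A) ∧ (A <ᵇ b)) ∨ ((b ≤ᵇ A) ∧ (A <ᵇ a))

xXxX : ℕ → ℕ → ℕ → ℕ → Bool
xXxX a b A B =
     ((a ≤ᵇ A) ∧ (A <ᵇ b) ∧ (b ≤ᵇ B))
  ∨ ((A <ᵇ b) ∧ (b ≤ᵇ B) ∧ (B <ᵇ a))
  ∨ ((b ≤ᵇ A) ∧ (A <ᵇ a) ∧ (a ≤ᵇ B))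
  ∨ ((A <ᵇ a) ∧ (a ≤ᵇ B) ∧ (B <ᵇ b))
  ∨ ((a ≤ᵇ B) ∧ (B <ᵇ b) ∧ (b ≤ᵇ A))
  ∨ ((B <ᵇ b) ∧ (b ≤ᵇ A) ∧ (A <ᵇ a))
  ∨ ((b ≤ᵇ B) ∧ (B <ᵇ a) ∧ (a ≤ᵇ A))
  ∨ ((B <ᵇ a) ∧ (a ≤ᵇ A) ∧ (A <ᵇ b))

swapRow : List ℕ → List ℕ
swapRow (a ∷ b ∷ r) = b ∷ a ∷ r
swapRow r = r

-- the while-loop: `prev` is the current (already swapped) row i,
-- the list holds rows i+1, i+2, … (up to row k+l)
loop : List ℕ → Filling → Filling
loop prev [] = []
loop prev (r ∷ rs) =
  if xXxX (e1 r) (e2 r) (e1 prev) (e2 prev)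
  then swapRow r ∷ loop (swapRow r) rs
  else r ∷ rs

lastRow : Filling → List ℕ
lastRow T with last T
... | just r = r
... | nothing = []

-- τ(T), for parameters k (and l, implicit in the number of rows of T)
τ : ℕ → Filling → Filling
τ k T with drop k T
... | [] = T
... | r ∷ rs =
  if xAx (e1 r) (e2 r) (e1 (lastRow (take k T)))
  then take k T ++ (swapRow r ∷ loop (swapRow r) rs)
  else T

-- τ changes a filling only by swapping the two entries of some rows, so it
-- preserves the shape, the positivity of the entries and the evaluation.  It is
-- an involution because both tests are symmetric: xAx in the two entries of the
-- upper row, xXxX in the two entries of each of its rows.  Running τ on τ(T), the
-- test on rows k, k+1 and every test of the chain see the same values as before,
-- up to these symmetries, so exactly the same rows are swapped back.  None of the
-- hypotheses on μ', k, l or ν is needed.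
module Submission where

open import Defs
open import Data.Nat.Base using (ℕ; zero; suc; _≤_; _+_; _<ᵇ_; _≤ᵇ_; _≡ᵇ_)
open import Data.Nat.Properties using (+-commutativeSemigroup)
open import Algebra.Properties.CommutativeSemigroup +-commutativeSemigroup using (x∙yz≈y∙xz)
open import Data.Bool.Base using (Bool; true; false; _∧_; _∨_; if_then_else_)
open import Data.Bool.Properties using (∨-assoc; ∨-comm)
open import Data.List.Base using (List; []; _∷_; _++_; take; drop; map; length; last)
open import Data.Nat.ListAction using (sum)
open import Data.List.Relation.Unary.All using (All; []; _∷_)
open import Data.List.Relation.Binary.Pointwise using (Pointwise; []; _∷_; ++⁺; Pointwise-≡⇒≡)
import Data.List.Relation.Binary.Pointwise as Pointwise
open import Data.Maybe.Base using (just)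
open import Data.Product.Base using (_×_; ∃; _,_)
open import Data.Sum.Base using (_⊎_; inj₁; inj₂)
open import Relation.Binary.PropositionalEquality
  using (_≡_; refl; sym; trans; cong; cong₂; module ≡-Reasoning)

private
  variable
    X : Set

∨-assoc₄ : ∀ x y z w v → x ∨ y ∨ z ∨ w ∨ v ≡ (x ∨ y ∨ z ∨ w) ∨ v
∨-assoc₄ true  _     _     _     _ = refl
∨-assoc₄ false true  _     _     _ = refl
∨-assoc₄ false false true  _     _ = refl
∨-assoc₄ false false false true  _ = refl
∨-assoc₄ false false false false _ = refl

∨-rotate₄ : ∀ x y z w → x ∨ y ∨ z ∨ w ≡ z ∨ w ∨ x ∨ y
∨-rotate₄ x y z w = begin
  x ∨ y ∨ z ∨ w       ≡⟨ sym (∨-assoc x y (z ∨ w)) ⟩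
  (x ∨ y) ∨ (z ∨ w)   ≡⟨ ∨-comm (x ∨ y) (z ∨ w) ⟩
  (z ∨ w) ∨ (x ∨ y)   ≡⟨ ∨-assoc z w (x ∨ y) ⟩
  z ∨ w ∨ x ∨ y       ∎
  where open ≡-Reasoning

xAx-comm : ∀ a b A → xAx b a A ≡ xAx a b A
xAx-comm a b A = ∨-comm ((b ≤ᵇ A) ∧ (A <ᵇ a)) ((a ≤ᵇ A) ∧ (A <ᵇ b))

xXxX-half : ℕ → ℕ → ℕ → ℕ → Bool
xXxX-half a b A B =
     ((a ≤ᵇ A) ∧ (A <ᵇ b) ∧ (b ≤ᵇ B))
  ∨ ((A <ᵇ b) ∧ (b ≤ᵇ B) ∧ (B <ᵇ a))
  ∨ ((b ≤ᵇ A) ∧ (A <ᵇ a) ∧ (a ≤ᵇ B))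
  ∨ ((A <ᵇ a) ∧ (a ≤ᵇ B) ∧ (B <ᵇ b))

xXxX-halves : ∀ a b A B → xXxX a b A B ≡ xXxX-half a b A B ∨ xXxX-half a b B A
xXxX-halves a b A B = ∨-assoc₄
  ((a ≤ᵇ A) ∧ (A <ᵇ b) ∧ (b ≤ᵇ B)) ((A <ᵇ b) ∧ (b ≤ᵇ B) ∧ (B <ᵇ a))
  ((b ≤ᵇ A) ∧ (A <ᵇ a) ∧ (a ≤ᵇ B)) ((A <ᵇ a) ∧ (a ≤ᵇ B) ∧ (B <ᵇ b))
  (xXxX-half a b B A)

xXxX-half-comm : ∀ a b A B → xXxX-half b a A B ≡ xXxX-half a b A B
xXxX-half-comm a b A B = ∨-rotate₄
  ((b ≤ᵇ A) ∧ (A <ᵇ a) ∧ (a ≤ᵇ B)) ((A <ᵇ a) ∧ (a ≤ᵇ B) ∧ (B <ᵇ b))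
  ((a ≤ᵇ A) ∧ (A <ᵇ b) ∧ (b ≤ᵇ B)) ((A <ᵇ b) ∧ (b ≤ᵇ B) ∧ (B <ᵇ a))

xXxX-commˡ : ∀ a b A B → xXxX b a A B ≡ xXxX a b A B
xXxX-commˡ a b A B = begin
  xXxX b a A B                                ≡⟨ xXxX-halves b a A B ⟩
  xXxX-half b a A B ∨ xXxX-half b a B A       ≡⟨ cong₂ _∨_ (xXxX-half-comm a b A B) (xXxX-half-comm a b B A) ⟩
  xXxX-half a b A B ∨ xXxX-half a b B A       ≡⟨ sym (xXxX-halves a b A B) ⟩
  xXxX a b A B                                ∎
  where open ≡-Reasoning

xXxX-commʳ : ∀ a b A B → xXxX a b B A ≡ xXxX a b A B
xXxX-commʳ a b A B = begin
  xXxX a b B A                                ≡⟨ xXxX-halves a b B A ⟩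
  xXxX-half a b B A ∨ xXxX-half a b A B       ≡⟨ ∨-comm (xXxX-half a b B A) (xXxX-half a b A B) ⟩
  xXxX-half a b A B ∨ xXxX-half a b B A       ≡⟨ sym (xXxX-halves a b A B) ⟩
  xXxX a b A B                                ∎
  where open ≡-Reasoning

swapRow-involutive : ∀ r → swapRow (swapRow r) ≡ r
swapRow-involutive []          = refl
swapRow-involutive (_ ∷ [])    = refl
swapRow-involutive (_ ∷ _ ∷ _) = refl

e1e2-swapRow : (f : ℕ → ℕ → X) → (∀ a b → f b a ≡ f a b) →
               ∀ r → f (e1 (swapRow r)) (e2 (swapRow r)) ≡ f (e1 r) (e2 r)
e1e2-swapRow f comm []          = refl
e1e2-swapRow f comm (_ ∷ [])    = refl
e1e2-swapRow f comm (a ∷ b ∷ _) = comm a b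

rows-xAx : List ℕ → List ℕ → Bool
rows-xAx upper lower = xAx (e1 upper) (e2 upper) (e1 lower)

rows-xXxX : List ℕ → List ℕ → Bool
rows-xXxX upper lower = xXxX (e1 upper) (e2 upper) (e1 lower) (e2 lower)

rows-xAx-swapˡ : ∀ r p → rows-xAx (swapRow r) p ≡ rows-xAx r p
rows-xAx-swapˡ r p = e1e2-swapRow (λ a b → xAx a b (e1 p)) (λ a b → xAx-comm a b (e1 p)) r

rows-xXxX-swapˡ : ∀ r p → rows-xXxX (swapRow r) p ≡ rows-xXxX r p
rows-xXxX-swapˡ r p = e1e2-swapRow (λ a b → xXxX a b (e1 p) (e2 p)) (λ a b → xXxX-commˡ a b (e1 p) (e2 p)) r

rows-xXxX-swapʳ : ∀ r p → rows-xXxX r (swapRow p) ≡ rows-xXxX r p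
rows-xXxX-swapʳ r p = e1e2-swapRow (xXxX (e1 r) (e2 r)) (xXxX-commʳ (e1 r) (e2 r)) p

rows-xXxX-swap : ∀ r p → rows-xXxX (swapRow r) p ≡ rows-xXxX r (swapRow p)
rows-xXxX-swap r p = trans (rows-xXxX-swapˡ r p) (sym (rows-xXxX-swapʳ r p))

loop-involutive : ∀ p rs → loop p (loop (swapRow p) rs) ≡ rs
loop-involutive p []       = refl
loop-involutive p (s ∷ ss) with rows-xXxX s (swapRow p) in test
... | true  rewrite trans (rows-xXxX-swap s p) test | swapRow-involutive s =
  cong (s ∷_) (loop-involutive s ss)
... | false rewrite trans (sym (rows-xXxX-swapʳ s p)) test = refl

data Cut : ℕ → Filling → Set where
  too-short : ∀ {k T} → drop k T ≡ [] → Cut k T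
  cut       : ∀ xs r rs → Cut (length xs) (xs ++ r ∷ rs)

cut? : ∀ k T → Cut k T
cut? zero    []      = too-short refl
cut? zero    (r ∷ T) = cut [] r T
cut? (suc k) []      = too-short refl
cut? (suc k) (x ∷ T) with cut? k T
... | too-short short = too-short short
... | cut xs r rs     = cut (x ∷ xs) r rs

take-length-++ : ∀ (xs ys : List X) → take (length xs) (xs ++ ys) ≡ xs
take-length-++ []       []       = refl
take-length-++ []       (_ ∷ _)  = refl
take-length-++ (x ∷ xs) ys       = cong (x ∷_) (take-length-++ xs ys)

drop-length-++ : ∀ (xs ys : List X) → drop (length xs) (xs ++ ys) ≡ ys
drop-length-++ []       ys = refl
drop-length-++ (_ ∷ xs) ys = drop-length-++ xs ys

τ-too-short : ∀ k T → drop k T ≡ [] → τ k T ≡ T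
τ-too-short k T short rewrite short = refl

τ-cut : ∀ xs r rs → τ (length xs) (xs ++ r ∷ rs) ≡
  (if rows-xAx r (lastRow xs)
   then xs ++ swapRow r ∷ loop (swapRow r) rs
   else xs ++ r ∷ rs)
τ-cut xs r rs rewrite drop-length-++ xs (r ∷ rs) | take-length-++ xs (r ∷ rs) = refl

τ-involutive : ∀ k T → τ k (τ k T) ≡ T
τ-involutive k T with cut? k T
... | too-short short = trans (cong (τ k) τT≡T) τT≡T
  where
  τT≡T : τ k T ≡ T
  τT≡T = τ-too-short k T short
... | cut xs r rs rewrite τ-cut xs r rs with rows-xAx r (lastRow xs) in test
...   | true  rewrite τ-cut xs (swapRow r) (loop (swapRow r) rs)
                    | trans (rows-xAx-swapˡ r (lastRow xs)) test
                    | swapRow-involutive r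
                    | loop-involutive r rs = refl
...   | false rewrite τ-cut xs r rs | test = refl

SwapOrSame : List ℕ → List ℕ → Set
SwapOrSame r s = r ≡ s ⊎ r ≡ swapRow s

RowSwaps : Filling → Filling → Set
RowSwaps = Pointwise SwapOrSame

RowSwaps-refl : ∀ T → RowSwaps T T
RowSwaps-refl T = Pointwise.refl (inj₁ refl)

loop-RowSwaps : ∀ p rs → RowSwaps (loop p rs) rs
loop-RowSwaps p []       = []
loop-RowSwaps p (r ∷ rs) with rows-xXxX r p
... | true  = inj₂ refl ∷ loop-RowSwaps (swapRow r) rs
... | false = RowSwaps-refl (r ∷ rs)

τ-RowSwaps : ∀ k T → RowSwaps (τ k T) T
τ-RowSwaps k T with cut? k T
... | too-short short rewrite τ-too-short k T short = RowSwaps-refl T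
... | cut xs r rs rewrite τ-cut xs r rs with rows-xAx r (lastRow xs)
...   | true  = ++⁺ (RowSwaps-refl xs) (inj₂ refl ∷ loop-RowSwaps (swapRow r) rs)
...   | false = RowSwaps-refl (xs ++ r ∷ rs)

map-RowSwaps : (f : List ℕ → X) → (∀ r → f (swapRow r) ≡ f r) →
               ∀ {T U} → RowSwaps T U → map f T ≡ map f U
map-RowSwaps f f-swap TU = Pointwise-≡⇒≡ (Pointwise.map⁺ f f (Pointwise.map same-image TU))
  where
  same-image : ∀ {r s} → SwapOrSame r s → f r ≡ f s
  same-image (inj₁ refl) = refl
  same-image (inj₂ refl) = f-swap _

All-RowSwaps : ∀ {P : List ℕ → Set} → (∀ {r} → P r → P (swapRow r)) →
               ∀ {T U} → RowSwaps T U → All P U → All P T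
All-RowSwaps P-swap []                 []       = []
All-RowSwaps P-swap (inj₁ refl ∷ TU) (p ∷ ps) = p ∷ All-RowSwaps P-swap TU ps
All-RowSwaps P-swap (inj₂ refl ∷ TU) (p ∷ ps) = P-swap p ∷ All-RowSwaps P-swap TU ps

length-swapRow : ∀ r → length (swapRow r) ≡ length r
length-swapRow []          = refl
length-swapRow (_ ∷ [])    = refl
length-swapRow (_ ∷ _ ∷ _) = refl

All-swapRow : ∀ {P : ℕ → Set} {r} → All P r → All P (swapRow r)
All-swapRow []           = []
All-swapRow (p ∷ [])     = p ∷ []
All-swapRow (p ∷ q ∷ ps) = q ∷ p ∷ ps

countRow-swapRow : ∀ m r → countRow m (swapRow r) ≡ countRow m r
countRow-swapRow m []          = refl
countRow-swapRow m (_ ∷ [])    = refl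
countRow-swapRow m (x ∷ y ∷ r) =
  x∙yz≈y∙xz (if m ≡ᵇ y then 1 else 0) (if m ≡ᵇ x then 1 else 0) (countRow m r)

count-sum : ∀ m T → count m T ≡ sum (map (countRow m) T)
count-sum m []      = refl
count-sum m (r ∷ T) = cong (countRow m r +_) (count-sum m T)

count-RowSwaps : ∀ m {T U} → RowSwaps T U → count m T ≡ count m U
count-RowSwaps m {T} {U} TU = begin
  count m T                 ≡⟨ count-sum m T ⟩
  sum (map (countRow m) T)  ≡⟨ cong sum (map-RowSwaps (countRow m) (countRow-swapRow m) TU) ⟩
  sum (map (countRow m) U)  ≡⟨ sym (count-sum m U) ⟩
  count m U                 ∎
  where open ≡-Reasoning

InF-RowSwaps : ∀ {μ ν T U} → RowSwaps T U → InF μ ν U → InF μ ν T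
InF-RowSwaps TU (shapeU , positiveU , countU) =
  trans (map-RowSwaps length length-swapRow TU) shapeU ,
  All-RowSwaps All-swapRow TU positiveU ,
  λ m → trans (count-RowSwaps m TU) (countU m)

proposition3 : (k l : ℕ) → 1 ≤ k → 1 ≤ l →
    (μ' : List ℕ) → IsPartition μ' → length μ' ≡ k →
    ∃ (λ m → last μ' ≡ just m × 2 ≤ m) →
    (ν : List ℕ) → IsComposition ν →
    (T : Filling) → InF (muShape μ' l) ν T →
    InF (muShape μ' l) ν (τ k T) × τ k (τ k T) ≡ T
proposition3 k _ _ _ _ _ _ _ _ _ T T∈F = InF-RowSwaps (τ-RowSwaps k T) T∈F , τ-involutive k T
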